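{- Let $d,M$ be positive integers, let $I\in\mathcal J_0$, let $W,G,A,G_0$ be constructed from $I$ as in the context, and let $j\in\{\pm1,\dots,\pm d\}$. Then the sets $I\setminus W$, $\sigma_j(I\cap W)$ and $G_0^j$ are pairwise disjoint, and their union is an independent set of $\Gamma$.
   Context: Let $\Gamma$ be the discrete torus $(\mathbb{Z}/2M\mathbb{Z})^d$ with its nearest-neighbor graph. Vertices are even/odd by parity of coordinate sum; $\mathcal E,\mathcal O$ are the even and odd vertices. $\Delta$ is the set of vertices with some coordinate equal to $M$ ($\equiv-M$). $N(S)$ denotes the set of neighbors of vertices of $S$; $\partial_{\mathrm{int}}S=\{v\in S:N(v)\not\subseteq S\}$. $\mathcal J$ is the set of independent sets $I$ of $\Gamma$ with $\Delta\cap\mathcal E\subseteq I$; $Z(I)$ is the component of $\Gamma-(I\cap\mathcal O)$ containing $\Delta$; fix an odd vertex $v_0$ and let $\mathcal J_0=\{I\in\mathcal J:v_0\notin Z(I)\}$. For $I\in\mathcal J_0$: $Z=Z(I)$, $Z_0=\partial_{\mathrm{int}}Z$; $W'$ is the component of $v_0$ in $\Gamma-(Z\setminus Z_0)$; $W''=W'\cup\{x\in\mathcal O:N(x)\subseteq W'\}$; $C$ is the component of $\Gamma-(W''\setminus\partial_{\mathrm{int}}W'')$ containing $\Delta$; $W=V(\Gamma)\setminus(C\setminus\partial_{\mathrm{int}}C)$, $G=W\cap\mathcal E$, $A=W\cap\mathcal O$, $G_0=\partial_{\mathrm{int}}W$. For $j\in\{\pm1,\dots,\pm d\}$ the shift $\sigma_j$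 is $\sigma_j(v)=v+e_j$, where $e_j$ is the $j$th standard basis vector for $j>0$ and $e_j=-e_{ -j}$ for $j<0$; and $G_0^j=\{v\in G_0:\sigma_j^{ -1}(v)\notin A\}$. -}

module Defs where

open import Data.Nat using (ℕ; zero; suc; _*_; _<_; _<?_; s≤s)
open import Data.Nat.Divisibility using (_∣_)
open import Data.Fin using (Fin; zero; suc; toℕ; fromℕ; fromℕ<; inject₁)
open import Data.Vec using (Vec; lookup; updateAt; map; sum)
open import Data.Bool using (Bool; true; false; not; T)
open import Data.Product using (Σ; ∃; _×_)
open import Data.Sum using (_⊎_)
open import Relation.Nullary using (¬_; yes; no)
open import Relation.Binary.PropositionalEquality using (_≡_)

-- cyclic successor / predecessor on ℤ/nℤ represented as Fin n
next : ∀ {n} → Fin n → Fin n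
next {suc n} i with suc (toℕ i) <? suc n
... | yes p = fromℕ< p
... | no _  = zero

prev : ∀ {n} → Fin n → Fin n
prev {suc n} zero    = fromℕ n
prev {suc n} (suc i) = inject₁ i

-- vertices of the torus (ℤ/2Mℤ)^d
-- (a record wrapper so that d and M can be inferred)
record Vertex (d M : ℕ) : Set where
  constructor vtx
  field
    coords : Vec (Fin (2 * M)) d
open Vertex public

VSet : ℕ → ℕ → Set₁
VSet d M = Vertex d M → Set

-- direction j ∈ {±1,…,±d} is encoded as (i : Fin d, s : Bool):
-- s = true means j = +(i+1), s = false means j = -(i+1).
-- σ i s v = v + e_j
σ : ∀ {d M} → Fin d → Bool → Vertex d M → Vertex d M
σ i true  v = vtx (updateAt (coords v) i next)
σ i false v = vtx (updateAt (coords v) i prev)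

σinv : ∀ {d M} → Fin d → Bool → Vertex d M → Vertex d M
σinv i s v = σ i (not s) v

Adj : ∀ {d M} → Vertex d M → Vertex d M → Set
Adj u v = Σ _ λ i → Σ Bool λ s → v ≡ σ i s u

Even : ∀ {d M} → Vertex d M → Set
Even v = 2 ∣ sum (map toℕ (coords v))

Odd : ∀ {d M} → Vertex d M → Set
Odd v = ¬ Even v

Δ : ∀ {d M} → VSet d M
Δ {M = M} v = Σ _ λ i → toℕ (lookup (coords v) i) ≡ M

Independent : ∀ {d M} → VSet d M → Set
Independent S = ∀ u v → S u → S v → ¬ Adj u v

data Conn {d M} (allowed : VSet d M) : Vertex d M → Vertex d M → Set where
  here : ∀ {x} → allowed x → Conn allowed x x
  step : ∀ {x y z} → Conn allowed x y → Adj y z → allowed z → Conn allowed x z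

Minus : ∀ {d M} → VSet d M → VSet d M
Minus S x = ¬ S x

CompΔ : ∀ {d M} → VSet d M → VSet d M
CompΔ S x = Σ _ λ δ → Δ δ × Conn (Minus S) δ x

CompOf : ∀ {d M} → Vertex d M → VSet d M → VSet d M
CompOf v S x = Conn (Minus S) v x

∂int : ∀ {d M} → VSet d M → VSet d M
∂int S v = S v × Σ _ λ u → Adj v u × ¬ S u

_∖_ : ∀ {d M} → VSet d M → VSet d M → VSet d M
(S ∖ T) x = S x × ¬ T x

_∩_ : ∀ {d M} → VSet d M → VSet d M → VSet d M
(S ∩ T) x = S x × T x

_∪_ : ∀ {d M} → VSet d M → VSet d M → VSet d M
(S ∪ T) x = S x ⊎ T x

Disjoint : ∀ {d M} → VSet d M → VSet d M → Set
Disjoint S T = ∀ x → ¬ (S x × T x)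

⟦_⟧ : ∀ {d M} → (Vertex d M → Bool) → VSet d M
⟦ I ⟧ v = T (I v)

σImage : ∀ {d M} → Fin d → Bool → VSet d M → VSet d M
σImage i s S x = S (σinv i s x)

InJ : ∀ {d M} → (Vertex d M → Bool) → Set
InJ I = Independent ⟦ I ⟧ × (∀ v → Δ v → Even v → ⟦ I ⟧ v)

Zof : ∀ {d M} → (Vertex d M → Bool) → VSet d M
Zof I = CompΔ (⟦ I ⟧ ∩ Odd)

InJ0 : ∀ {d M} → Vertex d M → (Vertex d M → Bool) → Set
InJ0 v0 I = InJ I × ¬ Zof I v0

Z0of : ∀ {d M} → (Vertex d M → Bool) → VSet d M
Z0of I = ∂int (Zof I)

W'of : ∀ {d M} → Vertex d M → (Vertex d M → Bool) → VSet d M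
W'of v0 I = CompOf v0 (Zof I ∖ Z0of I)

W''of : ∀ {d M} → Vertex d M → (Vertex d M → Bool) → VSet d M
W''of v0 I x = W'of v0 I x ⊎ (Odd x × (∀ y → Adj x y → W'of v0 I y))

Cof : ∀ {d M} → Vertex d M → (Vertex d M → Bool) → VSet d M
Cof v0 I = CompΔ (W''of v0 I ∖ ∂int (W''of v0 I))

Wof : ∀ {d M} → Vertex d M → (Vertex d M → Bool) → VSet d M
Wof v0 I x = ¬ ((Cof v0 I ∖ ∂int (Cof v0 I)) x)

Gof : ∀ {d M} → Vertex d M → (Vertex d M → Bool) → VSet d M
Gof v0 I = Wof v0 I ∩ Even

Aof : ∀ {d M} → Vertex d M → (Vertex d M → Bool) → VSet d M
Aof v0 I = Wof v0 I ∩ Odd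

G0of : ∀ {d M} → Vertex d M → (Vertex d M → Bool) → VSet d M
G0of v0 I = ∂int (Wof v0 I)

G0jof : ∀ {d M} → Vertex d M → (Vertex d M → Bool) → Fin d → Bool → VSet d M
G0jof v0 I i s v = G0of v0 I v × ¬ Aof v0 I (σinv i s v)

-- Since 2M is even the torus is bipartite: σⱼ changes the coordinate sum by ±1 or ∓(2M − 1).
-- Odd vertices of W' are interior to W'' and hence lie in W; from this one gets the two facts
-- that carry the proof: every vertex of G₀ = ∂_int W is an even vertex of W' outside I, and a
-- vertex of I adjacent to an even vertex of W' lies in W.  Thus I ∩ W never has a neighbour
-- outside W, I ∖ W has no neighbour in W, and G₀ʲ is even with σⱼ⁻¹(G₀ʲ) outside W; every pair
-- of the three sets is separated by one of these facts, by bipartiteness, or by independence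
-- of I and of its translate.  Membership in the components is undecidable, so the facts are
-- proved under double negation, which suffices because every goal is negative.
module Submission where

open import Defs
open import Data.Nat using (ℕ; zero; suc; _+_; _≤_; _<_; _<?_; s≤s)
open import Data.Nat.Properties
  using (+-comm; +-assoc; +-suc; +-identityʳ; +-cancelʳ-≡; suc-injective;
         ≤-antisym; ≤-pred; ≮⇒≥; <-irrefl; +-commutativeSemigroup)
open import Data.Nat.Divisibility using (_∣_; _∤_; divides; ∣m+n∣m⇒∣n; ∣m∣n⇒∣m+n; ∣1⇒≡1; m∣m*n)
open import Algebra.Properties.CommutativeSemigroup +-commutativeSemigroup using (xy∙z≈xz∙y; xy∙z≈zy∙x)
open import Data.Fin using (Fin; zero; suc; toℕ; fromℕ; fromℕ<; inject₁)
open import Data.Fin.Properties using (toℕ-injective; toℕ-fromℕ<; toℕ-fromℕ; toℕ-inject₁; toℕ<n)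
open import Data.Vec using (Vec; _∷_; lookup; updateAt; map; sum)
open import Data.Vec.Properties using (updateAt-updateAt; updateAt-cong; updateAt-id)
open import Data.Bool using (Bool; true; false; not)
open import Data.Product using (∃; _×_; _,_; proj₁; proj₂)
open import Data.Sum using (_⊎_; inj₁; inj₂)
open import Data.Empty using (⊥; ⊥-elim)
open import Effect.Monad using (RawMonad)
open import Function using (_∘_)
open import Level using (0ℓ)
open import Relation.Nullary using (¬_; yes; no)
open import Relation.Nullary.Negation using (¬¬-Monad; negated-stable)
open import Relation.Binary.PropositionalEquality
open ≡-Reasoning

2∣n⊎2∣1+n : ∀ n → 2 ∣ n ⊎ 2 ∣ suc n
2∣n⊎2∣1+n zero = inj₁ (divides 0 refl)
2∣n⊎2∣1+n (suc n) with 2∣n⊎2∣1+n n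
... | inj₁ (divides q eq) = inj₂ (divides (suc q) (cong (2 +_) eq))
... | inj₂ 2∣1+n = inj₁ 2∣1+n

2∤1 : 2 ∤ 1
2∤1 2∣1 with ∣1⇒≡1 2∣1
... | ()

+even≡suc⇒opposite-parity : ∀ {a b c} → a + c ≡ suc b → 2 ∣ c →
                             (2 ∣ a → 2 ∤ b) × (2 ∤ a → 2 ∤ b → ⊥)
+even≡suc⇒opposite-parity {a} {b} {c} a+c≡1+b 2∣c = even⇒odd , odd⇒even
  where
  even⇒odd : 2 ∣ a → 2 ∤ b
  even⇒odd 2∣a 2∣b = 2∤1 (∣m+n∣m⇒∣n (subst (2 ∣_) (trans a+c≡1+b (+-comm 1 b)) (∣m∣n⇒∣m+n 2∣a 2∣c)) 2∣b)
  odd⇒even : 2 ∤ a → 2 ∤ b → ⊥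
  odd⇒even 2∤a 2∤b with 2∣n⊎2∣1+n b
  ... | inj₁ 2∣b = 2∤b 2∣b
  ... | inj₂ 2∣1+b = 2∤a (∣m+n∣m⇒∣n (subst (2 ∣_) (trans (sym a+c≡1+b) (+-comm a c)) 2∣1+b) 2∣c)

toℕ-next : ∀ {n} → 2 ∣ n → (a : Fin n) → ∃ λ c → 2 ∣ c × toℕ (next a) + c ≡ suc (toℕ a)
toℕ-next {suc n} 2∣n a with suc (toℕ a) <? suc n
... | yes a+1<n = 0 , divides 0 refl , trans (+-identityʳ _) (toℕ-fromℕ< a+1<n)
... | no a+1≮n = suc n , 2∣n , sym (≤-antisym (toℕ<n a) (≮⇒≥ a+1≮n))

toℕ-prev : ∀ {n m} (b : Fin (suc n)) → toℕ b ≡ suc m → toℕ (prev b) ≡ m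
toℕ-prev (suc b) b≡1+m = trans (toℕ-inject₁ b) (suc-injective b≡1+m)

prev-next : ∀ {n} (a : Fin n) → prev (next a) ≡ a
prev-next {suc n} a with suc (toℕ a) <? suc n
... | yes a+1<n = toℕ-injective (toℕ-prev (fromℕ< a+1<n) (toℕ-fromℕ< a+1<n))
... | no a+1≮n = toℕ-injective (trans (toℕ-fromℕ n) (sym (≤-antisym (≤-pred (toℕ<n a)) (≤-pred (≮⇒≥ a+1≮n)))))

next-prev : ∀ {n} (a : Fin n) → next (prev a) ≡ a
next-prev {suc n} zero with suc (toℕ (fromℕ n)) <? suc n
... | yes n+1<n = ⊥-elim (<-irrefl (cong suc (toℕ-fromℕ n)) n+1<n)
... | no _ = refl
next-prev {suc n} (suc a) with suc (toℕ (inject₁ a)) <? suc n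
... | yes a+1<n = toℕ-injective (trans (toℕ-fromℕ< a+1<n) (cong suc (toℕ-inject₁ a)))
... | no a+1≮n = ⊥-elim (a+1≮n (s≤s (subst (_< n) (sym (toℕ-inject₁ a)) (toℕ<n a))))

shift : ∀ {n} → Bool → Fin n → Fin n
shift true  = next
shift false = prev

shift-comm : ∀ {n} s t (a : Fin n) → shift s (shift t a) ≡ shift t (shift s a)
shift-comm true  true  a = refl
shift-comm true  false a = trans (next-prev a) (sym (prev-next a))
shift-comm false true  a = trans (prev-next a) (sym (next-prev a))
shift-comm false false a = refl

shift-shift-not : ∀ {n} s (a : Fin n) → shift s (shift (not s) a) ≡ a
shift-shift-not true  = next-prev
shift-shift-not false = prev-next

σ-updateAt : ∀ {d M} i s (v : Vertex d M) → σ i s v ≡ vtx (updateAt (coords v) i (shift s))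
σ-updateAt i true  v = refl
σ-updateAt i false v = refl

updateAt-comm : ∀ {A : Set} {n} {f g : A → A} → (∀ x → f (g x) ≡ g (f x)) →
                (xs : Vec A n) (i j : Fin n) →
                updateAt (updateAt xs i g) j f ≡ updateAt (updateAt xs j f) i g
updateAt-comm fg≡gf (x ∷ xs) zero    zero    = cong (_∷ xs) (fg≡gf x)
updateAt-comm fg≡gf (x ∷ xs) zero    (suc j) = refl
updateAt-comm fg≡gf (x ∷ xs) (suc i) zero    = refl
updateAt-comm fg≡gf (x ∷ xs) (suc i) (suc j) = cong (x ∷_) (updateAt-comm fg≡gf xs i j)

σ-comm : ∀ {d M} i s j t (v : Vertex d M) → σ j t (σ i s v) ≡ σ i s (σ j t v)
σ-comm i s j t v = begin
  σ j t (σ i s v)                                               ≡⟨ cong (σ j t) (σ-updateAt i s v) ⟩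
  σ j t (vtx (updateAt (coords v) i (shift s)))                 ≡⟨ σ-updateAt j t _ ⟩
  vtx (updateAt (updateAt (coords v) i (shift s)) j (shift t))  ≡⟨ cong vtx (updateAt-comm (shift-comm t s) (coords v) i j) ⟩
  vtx (updateAt (updateAt (coords v) j (shift t)) i (shift s))  ≡⟨ σ-updateAt i s _ ⟨
  σ i s (vtx (updateAt (coords v) j (shift t)))                 ≡⟨ cong (σ i s) (σ-updateAt j t v) ⟨
  σ i s (σ j t v)                                               ∎

σ-σ-not : ∀ {d M} i s (v : Vertex d M) → σ i s (σ i (not s) v) ≡ v
σ-σ-not i s v = begin
  σ i s (σ i (not s) v)                                               ≡⟨ cong (σ i s) (σ-updateAt i (not s) v) ⟩
  σ i s (vtx (updateAt (coords v) i (shift (not s))))                 ≡⟨ σ-updateAt i s _ ⟩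
  vtx (updateAt (updateAt (coords v) i (shift (not s))) i (shift s))  ≡⟨ cong vtx (updateAt-updateAt i (coords v)) ⟩
  vtx (updateAt (coords v) i (λ a → shift s (shift (not s) a)))       ≡⟨ cong vtx (updateAt-cong i (shift-shift-not s) (coords v)) ⟩
  vtx (updateAt (coords v) i (λ a → a))                               ≡⟨ cong vtx (updateAt-id i (coords v)) ⟩
  v                                                                   ∎

σ-not-σ : ∀ {d M} i s (v : Vertex d M) → σ i (not s) (σ i s v) ≡ v
σ-not-σ i true  = σ-σ-not i false
σ-not-σ i false = σ-σ-not i true

Adj-sym : ∀ {d M} {u v : Vertex d M} → Adj u v → Adj v u
Adj-sym {u = u} (i , s , refl) = i , not s , sym (σ-not-σ i s u)

Adj-σinv : ∀ {d M} i s (v : Vertex d M) → Adj v (σinv i s v)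
Adj-σinv i s v = i , not s , refl

σinv-preserves-Adj : ∀ {d M} i s {u v : Vertex d M} → Adj u v → Adj (σinv i s u) (σinv i s v)
σinv-preserves-Adj i s {u} (j , t , refl) = j , t , σ-comm j t i (not s) u

coordSum : ∀ {d M} → Vertex d M → ℕ
coordSum v = sum (map toℕ (coords v))

sum-map-updateAt : ∀ {A : Set} {n} (f : A → ℕ) (g : A → A) (xs : Vec A n) i →
                   sum (map f (updateAt xs i g)) + f (lookup xs i) ≡ sum (map f xs) + f (g (lookup xs i))
sum-map-updateAt f g (x ∷ xs) zero    = xy∙z≈zy∙x (f (g x)) (sum (map f xs)) (f x)
sum-map-updateAt f g (x ∷ xs) (suc i) = begin
  f x + sum (map f (updateAt xs i g)) + f (lookup xs i)    ≡⟨ +-assoc (f x) _ _ ⟩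
  f x + (sum (map f (updateAt xs i g)) + f (lookup xs i))  ≡⟨ cong (f x +_) (sum-map-updateAt f g xs i) ⟩
  f x + (sum (map f xs) + f (g (lookup xs i)))             ≡⟨ +-assoc (f x) _ _ ⟨
  f x + sum (map f xs) + f (g (lookup xs i))               ∎

coordSum-σ-next : ∀ {d M} i (v : Vertex d M) → ∃ λ c → 2 ∣ c × coordSum (σ i true v) + c ≡ suc (coordSum v)
coordSum-σ-next {M = M} i v with toℕ-next (m∣m*n M) (lookup (coords v) i)
... | c , 2∣c , next+c≡1+a = c , 2∣c , +-cancelʳ-≡ a (S′ + c) (suc S) (begin
  S′ + c + a               ≡⟨ xy∙z≈xz∙y S′ c a ⟩
  S′ + a + c               ≡⟨ cong (_+ c) (sum-map-updateAt toℕ next (coords v) i) ⟩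
  S + toℕ (next a′) + c    ≡⟨ +-assoc S _ c ⟩
  S + (toℕ (next a′) + c)  ≡⟨ cong (S +_) next+c≡1+a ⟩
  S + suc a                ≡⟨ +-suc S a ⟩
  suc S + a                ∎)
  where
  a′ = lookup (coords v) i
  a = toℕ a′
  S = coordSum v
  S′ = coordSum (σ i true v)

OppositeParity : ∀ {d M} → Vertex d M → Vertex d M → Set
OppositeParity u v = (Even u → Odd v) × (Odd u → Odd v → ⊥)

σ-next-opposite-parity : ∀ {d M} i (v : Vertex d M) → OppositeParity (σ i true v) v
σ-next-opposite-parity i v with coordSum-σ-next i v
... | c , 2∣c , eq = +even≡suc⇒opposite-parity eq 2∣c

OppositeParity-sym : ∀ {d M} {u v : Vertex d M} → OppositeParity u v → OppositeParity v u
OppositeParity-sym (even⇒odd , odd⇒even) = (λ ev eu → even⇒odd eu ev) , (λ ov ou → odd⇒even ou ov)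

Adj⇒OppositeParity : ∀ {d M} {u v : Vertex d M} → Adj u v → OppositeParity u v
Adj⇒OppositeParity {u = u} (i , true , refl) = OppositeParity-sym {u = σ i true u} {v = u} (σ-next-opposite-parity i u)
Adj⇒OppositeParity {u = u} (i , false , refl) =
  subst (λ w → OppositeParity w (σ i false u)) (σ-σ-not i true u) (σ-next-opposite-parity i (σ i false u))

Adj-even⇒odd : ∀ {d M} {u v : Vertex d M} → Adj u v → Even u → Odd v
Adj-even⇒odd a = proj₁ (Adj⇒OppositeParity a)

Adj-odd⇒¬odd : ∀ {d M} {u v : Vertex d M} → Adj u v → Odd u → ¬ Odd v
Adj-odd⇒¬odd a = proj₂ (Adj⇒OppositeParity a)

Interior : ∀ {d M} → VSet d M → VSet d M
Interior S = S ∖ ∂int S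

Interior-Adj : ∀ {d M} {S : VSet d M} {x y} → Interior S x → Adj x y → ¬ ¬ S y
Interior-Adj (Sx , x∉∂S) x~y y∉S = x∉∂S (Sx , _ , x~y , y∉S)

¬Interior⇒∂int : ∀ {d M} {S : VSet d M} {x} → S x → ¬ Interior S x → ¬ ¬ ∂int S x
¬Interior⇒∂int Sx x∉S° x∉∂S = x∉S° (Sx , x∉∂S)

Conn⇒allowed : ∀ {d M} {S : VSet d M} {a x} → Conn S a x → S x
Conn⇒allowed (here Sx)     = Sx
Conn⇒allowed (step _ _ Sx) = Sx

CompΔ⇒∉ : ∀ {d M} {S : VSet d M} {x} → CompΔ S x → ¬ S x
CompΔ⇒∉ (_ , _ , path) = Conn⇒allowed path

CompΔ-exit : ∀ {d M} {S : VSet d M} {x y} → CompΔ S x → Adj x y → ¬ CompΔ S y → ¬ ¬ S y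
CompΔ-exit (δ , Δδ , path) x~y y∉K y∉S = y∉K (δ , Δδ , step path x~y y∉S)

module Construction {d M : ℕ} (v0 : Vertex d M) (I : Vertex d M → Bool)
                    (I-independent : Independent ⟦ I ⟧) where
  open RawMonad (¬¬-Monad {0ℓ})

  Zᴵ W' W'' W : VSet d M
  Zᴵ = Zof I
  W' = W'of v0 I
  W'' = W''of v0 I
  W = Wof v0 I

  odd-Z⊆Interior : ∀ {v} → Zᴵ v → Odd v → Interior Zᴵ v
  odd-Z⊆Interior Zv ov = Zv , λ { (_ , t , v~t , t∉Z) → CompΔ-exit Zv v~t t∉Z λ (_ , ot) → Adj-odd⇒¬odd v~t ov ot }

  odd-W'⊆Interior-W'' : ∀ {u} → W' u → Odd u → Interior W'' u
  odd-W'⊆Interior-W'' W'u ou = inj₁ W'u , λ { (_ , y , u~y , y∉W'') →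
    y∉W'' (inj₁ (step W'u u~y λ y∈Z° → Interior-Adj y∈Z° (Adj-sym u~y) λ Zu →
      Conn⇒allowed W'u (odd-Z⊆Interior Zu ou))) }

  odd-W'⊆W : ∀ {u} → W' u → Odd u → W u
  odd-W'⊆W W'u ou (Cu , _) = CompΔ⇒∉ Cu (odd-W'⊆Interior-W'' W'u ou)

  I-Adj-even-W'⊆W : ∀ {x y} → ⟦ I ⟧ x → W' y → Even y → Adj y x → W x
  I-Adj-even-W'⊆W {x} Ix W'y ey y~x = odd-W'⊆W (step W'y y~x λ x∈Z° → CompΔ⇒∉ (proj₁ x∈Z°) (Ix , ox)) ox
    where
    ox : Odd x
    ox = Adj-even⇒odd y~x ey

  ∂W⊆W''∖Interior : ∀ {v} → ∂int W v → ¬ ¬ (W'' v × ¬ Interior W'' v)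
  ∂W⊆W''∖Interior (Wv , u , v~u , u∉W) = do
    u∈C° ← u∉W
    Cv ← Interior-Adj u∈C° (Adj-sym v~u)
    (_ , w , v~w , w∉C) ← ¬Interior⇒∂int Cv Wv
    w∈W''° ← CompΔ-exit Cv v~w w∉C
    W''v ← Interior-Adj w∈W''° (Adj-sym v~w)
    pure (W''v , CompΔ⇒∉ Cv)

  W''∖Interior⊆even-W' : ∀ {v} → W'' v → ¬ Interior W'' v → ¬ ¬ (W' v × Even v)
  W''∖Interior⊆even-W' (inj₁ W'v) v∉W''° = do
    ev ← λ ov → v∉W''° (odd-W'⊆Interior-W'' W'v ov)
    pure (W'v , ev)
  W''∖Interior⊆even-W' {v} (inj₂ (ov , N[v]⊆W')) v∉W''° = ⊥-elim (v∉W''° v∈W''°)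
    where
    v∈W''° : Interior W'' v
    v∈W''° = inj₂ (ov , N[v]⊆W') , λ { (_ , y , v~y , y∉W'') → y∉W'' (inj₁ (N[v]⊆W' y v~y)) }

  even-W'-exit⇒∉I : ∀ {v u} → W' v → Even v → Adj v u → ¬ W u → ¬ ⟦ I ⟧ v
  even-W'-exit⇒∉I {v} W'v ev v~u u∉W = negated-stable do
    u∈Z° ← λ u∉Z° → u∉W (odd-W'⊆W (step W'v v~u u∉Z°) (Adj-even⇒odd v~u ev))
    Zv ← Interior-Adj u∈Z° (Adj-sym v~u)
    (_ , t , v~t , t∉Z) ← ¬Interior⇒∂int Zv (Conn⇒allowed W'v)
    (It , _) ← CompΔ-exit Zv v~t t∉Z
    pure λ Iv → I-independent v t Iv It v~t

  G₀⊆even-W'∖I : ∀ {v} → G0of v0 I v → ¬ ¬ (Even v × W' v × ¬ ⟦ I ⟧ v)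
  G₀⊆even-W'∖I v∈∂W@(_ , u , v~u , u∉W) = do
    (W''v , v∉W''°) ← ∂W⊆W''∖Interior v∈∂W
    (W'v , ev) ← W''∖Interior⊆even-W' W''v v∉W''°
    pure (ev , W'v , even-W'-exit⇒∉I W'v ev v~u u∉W)

  I∩W-Adj⇒W : ∀ {x y} → ⟦ I ⟧ x → W x → Adj x y → ¬ ¬ W y
  I∩W-Adj⇒W Ix Wx x~y y∉W = G₀⊆even-W'∖I (Wx , _ , x~y , y∉W) λ (_ , _ , x∉I) → x∉I Ix

  I∖W-Adj⇒∉W : ∀ {x y} → ⟦ I ⟧ x → ¬ W x → Adj x y → ¬ W y
  I∖W-Adj⇒∉W Ix x∉W x~y Wy = G₀⊆even-W'∖I (Wy , _ , Adj-sym x~y , x∉W) λ (ey , W'y , _) →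
    x∉W (I-Adj-even-W'⊆W Ix W'y ey (Adj-sym x~y))

  module Pieces (i : Fin d) (s : Bool) where
    X Y Z : VSet d M
    X = ⟦ I ⟧ ∖ W
    Y = σImage i s (⟦ I ⟧ ∩ W)
    Z = G0jof v0 I i s

    Z⊆Even : ∀ {z} → Z z → ¬ ¬ Even z
    Z⊆Even (z∈∂W , _) ¬ez = G₀⊆even-W'∖I z∈∂W λ (ez , _) → ¬ez ez

    Z-even⇒σinv∉W : ∀ {z} → Z z → Even z → ¬ W (σinv i s z)
    Z-even⇒σinv∉W {z} (_ , σ⁻¹z∉A) ez Wσ⁻¹z = σ⁻¹z∉A (Wσ⁻¹z , Adj-even⇒odd (Adj-σinv i s z) ez)

    X∩Y=∅ : Disjoint X Y
    X∩Y=∅ x ((Ix , _) , (Iσ⁻¹x , _)) = I-independent x _ Ix Iσ⁻¹x (Adj-σinv i s x)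

    X∩Z=∅ : Disjoint X Z
    X∩Z=∅ x ((_ , x∉W) , ((Wx , _) , _)) = x∉W Wx

    Y∩Z=∅ : Disjoint Y Z
    Y∩Z=∅ z ((_ , Wσ⁻¹z) , Zz) = Z⊆Even Zz λ ez → Z-even⇒σinv∉W Zz ez Wσ⁻¹z

    X-Y : ∀ {u v} → X u → Y v → ¬ Adj u v
    X-Y {v = v} (Iu , u∉W) (Iσ⁻¹v , Wσ⁻¹v) u~v =
      I∩W-Adj⇒W Iσ⁻¹v Wσ⁻¹v (Adj-sym (Adj-σinv i s v)) (I∖W-Adj⇒∉W Iu u∉W u~v)

    X-Z : ∀ {u v} → X u → Z v → ¬ Adj u v
    X-Z (Iu , u∉W) ((Wv , _) , _) u~v = I∖W-Adj⇒∉W Iu u∉W u~v Wv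

    Y-Y : ∀ {u v} → Y u → Y v → ¬ Adj u v
    Y-Y (Iσ⁻¹u , _) (Iσ⁻¹v , _) u~v = I-independent _ _ Iσ⁻¹u Iσ⁻¹v (σinv-preserves-Adj i s u~v)

    Y-Z : ∀ {u v} → Y u → Z v → ¬ Adj u v
    Y-Z (Iσ⁻¹u , Wσ⁻¹u) Zv u~v = Z⊆Even Zv λ ev →
      I∩W-Adj⇒W Iσ⁻¹u Wσ⁻¹u (σinv-preserves-Adj i s u~v) (Z-even⇒σinv∉W Zv ev)

    Z-Z : ∀ {u v} → Z u → Z v → ¬ Adj u v
    Z-Z Zu Zv u~v = Z⊆Even Zu λ eu → Z⊆Even Zv λ ev → Adj-even⇒odd u~v eu ev

    X∪Y∪Z-independent : Independent (X ∪ (Y ∪ Z))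
    X∪Y∪Z-independent u v (inj₁ Xu)        (inj₁ Xv)        = I-independent u v (proj₁ Xu) (proj₁ Xv)
    X∪Y∪Z-independent u v (inj₁ Xu)        (inj₂ (inj₁ Yv)) = X-Y Xu Yv
    X∪Y∪Z-independent u v (inj₁ Xu)        (inj₂ (inj₂ Zv)) = X-Z Xu Zv
    X∪Y∪Z-independent u v (inj₂ (inj₁ Yu)) (inj₁ Xv)        = X-Y Xv Yu ∘ Adj-sym
    X∪Y∪Z-independent u v (inj₂ (inj₁ Yu)) (inj₂ (inj₁ Yv)) = Y-Y Yu Yv
    X∪Y∪Z-independent u v (inj₂ (inj₁ Yu)) (inj₂ (inj₂ Zv)) = Y-Z Yu Zv
    X∪Y∪Z-independent u v (inj₂ (inj₂ Zu)) (inj₁ Xv)        = X-Z Xv Zu ∘ Adj-sym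
    X∪Y∪Z-independent u v (inj₂ (inj₂ Zu)) (inj₂ (inj₁ Yv)) = Y-Z Yv Zu ∘ Adj-sym
    X∪Y∪Z-independent u v (inj₂ (inj₂ Zu)) (inj₂ (inj₂ Zv)) = Z-Z Zu Zv

proposition2p12 : (d M : ℕ) → 1 ≤ d → 1 ≤ M →
    (v0 : Vertex d M) → Odd v0 →
    (I : Vertex d M → Bool) → InJ0 v0 I →
    (i : Fin d) (s : Bool) →
    let X = ⟦ I ⟧ ∖ Wof v0 I
        Y = σImage i s (⟦ I ⟧ ∩ Wof v0 I)
        Z = G0jof v0 I i s
    in (Disjoint X Y × Disjoint X Z × Disjoint Y Z)
       × Independent (X ∪ (Y ∪ Z))
proposition2p12 d M _ _ v0 _ I ((I-independent , _) , _) i s =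
  (X∩Y=∅ , X∩Z=∅ , Y∩Z=∅) , X∪Y∪Z-independent
  where
  open Construction v0 I I-independent
  open Pieces i s
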